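{- Let $n$ be a positive integer and let $w_1 \leq \dots \leq w_m$ be a feasible partition of $n$. Then for every $i$ with $1 \leq i \leq m$, $R_{i-1} \geq \frac{R_i - 1}{3}$.
   Context: A feasible partition of a positive integer $n$ is a nondecreasing sequence of positive integers $w_1 \leq \dots \leq w_m$ with $w_1 + \dots + w_m = n$ such that (i) every integer $k$ with $1 \leq k \leq n$ can be written as $k = \sum_{i=1}^m u_i w_i$ with each $u_i \in \{ -1,0,1\}$, and (ii) $m$ is the minimum possible number of parts among all sequences of positive integers summing to $n$ with property (i). For such a partition, $R_i = w_1 + \dots + w_i$ for $1 \leq i \leq m$, and $R_0 = 0$. -}

module Defs where

open import Data.Nat using (ℕ; zero; suc; _+_; _*_; _≤_; _<_)
open import Data.Integer as ℤ using (ℤ; +_)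
open import Data.List using (List; []; _∷_; length; take)
open import Data.Nat.ListAction using (sum)
open import Data.List.Relation.Unary.All using (All)
open import Data.List.Relation.Unary.Sorted.TotalOrder using (Sorted)
open import Data.Nat.Properties using (≤-totalOrder)
open import Data.Product using (Σ; _×_)
open import Relation.Binary.PropositionalEquality using (_≡_)

data Coef : Set where
  neg zer pos : Coef

coefTimes : Coef → ℕ → ℤ
coefTimes neg w = ℤ.- (+ w)
coefTimes zer w = + 0
coefTimes pos w = + w

-- Σ u_i w_i (coefficient list paired with parts; extra entries ignored,
-- lengths are required equal where used)
signedSum : List ℕ → List Coef → ℤ
signedSum (w ∷ ws) (u ∷ us) = coefTimes u w ℤ.+ signedSum ws us
signedSum _ _ = + 0

Representable : List ℕ → ℕ → Set
Representable ws k = Σ (List Coef) λ us → (length us ≡ length ws) × (signedSum ws us ≡ + k)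

Covers : ℕ → List ℕ → Set
Covers n ws = ∀ k → 1 ≤ k → k ≤ n → Representable ws k

Admissible : ℕ → List ℕ → Set
Admissible n ws = All (λ w → 1 ≤ w) ws × (sum ws ≡ n) × Covers n ws

Feasible : ℕ → List ℕ → Set
Feasible n ws =
  Sorted ≤-totalOrder ws × Admissible n ws ×
  (∀ vs → Admissible n vs → length ws ≤ length vs)

R : List ℕ → ℕ → ℕ
R ws i = sum (take i ws)

-- Write a representation of k as k = Σ uᵢwᵢ in terms of its deficit Σ (wᵢ − uᵢwᵢ) = n − k,
-- in which every part contributes 0, wᵢ or 2wᵢ. If the part w after R_{i-1} were at least
-- 2R_{i-1} + 2, then k = n − (2R_{i-1} + 1) would need deficit 2R_{i-1} + 1 < w. Since the
-- sequence is sorted, w and all later parts contribute 0 or at least w, hence nothing, and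
-- the earlier parts contribute at most 2R_{i-1}: too little.
module Submission where

open import Defs
open import Data.Nat using (ℕ; zero; suc; _+_; _*_; _∸_; _≤_; _<_; _≤?_; z≤n; s≤s; z<s)
open import Data.Nat.Properties
open import Data.Nat.ListAction using (sum)
open import Data.Nat.ListAction.Properties using (sum-++)
open import Data.Nat.Tactic.RingSolver as ℕ-Solver using ()
open import Data.Integer as ℤ using (ℤ; +_)
open import Data.Integer.Properties as ℤ using ()
open import Data.Integer.Tactic.RingSolver as ℤ-Solver using ()
open import Data.List using (List; []; _∷_; _++_; length; take; drop)
open import Data.List.Properties using (take++drop≡id)
open import Data.List.Relation.Unary.All using (All; []; _∷_)
open import Data.List.Relation.Unary.AllPairs using (AllPairs; _∷_)
open import Data.List.Relation.Unary.AllPairs.Properties using (drop⁺)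
open import Data.List.Relation.Unary.Linked.Properties using (Linked⇒AllPairs)
open import Data.List.Relation.Unary.Sorted.TotalOrder using (Sorted)
open import Data.Product using (Σ; _,_; proj₁; proj₂)
open import Data.Sum using (_⊎_; inj₁; inj₂)
open import Relation.Binary.PropositionalEquality
open import Relation.Nullary using (yes; no)
open import Relation.Nullary.Negation using (contradiction)

deficit : Coef → ℕ → ℕ
deficit neg w = w + w
deficit zer w = w
deficit pos w = 0

deficitSum : List ℕ → List Coef → ℕ
deficitSum (w ∷ ws) (u ∷ us) = deficit u w + deficitSum ws us
deficitSum _ _ = 0

coefTimes+deficit≡ : ∀ u w → coefTimes u w ℤ.+ + deficit u w ≡ + w
coefTimes+deficit≡ neg w = -a+[a+a]≡a (+ w)
  where
  -a+[a+a]≡a : ∀ (a : ℤ) → ℤ.- a ℤ.+ (a ℤ.+ a) ≡ a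
  -a+[a+a]≡a = ℤ-Solver.solve-∀
coefTimes+deficit≡ zer w = refl
coefTimes+deficit≡ pos w = ℤ.+-identityʳ (+ w)

signedSum+deficitSum≡sum : ∀ ws us → length us ≡ length ws →
  signedSum ws us ℤ.+ + deficitSum ws us ≡ + sum ws
signedSum+deficitSum≡sum [] [] _ = refl
signedSum+deficitSum≡sum (w ∷ ws) (u ∷ us) eq = begin
  (coefTimes u w ℤ.+ signedSum ws us) ℤ.+ (+ deficit u w ℤ.+ + deficitSum ws us)
    ≡⟨ interchange (coefTimes u w) _ _ _ ⟩
  (coefTimes u w ℤ.+ + deficit u w) ℤ.+ (signedSum ws us ℤ.+ + deficitSum ws us)
    ≡⟨ cong₂ ℤ._+_ (coefTimes+deficit≡ u w) (signedSum+deficitSum≡sum ws us (suc-injective eq)) ⟩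
  + (w + sum ws) ∎
  where
  open ≡-Reasoning
  interchange : ∀ (a b c e : ℤ) → (a ℤ.+ b) ℤ.+ (c ℤ.+ e) ≡ (a ℤ.+ c) ℤ.+ (b ℤ.+ e)
  interchange = ℤ-Solver.solve-∀

representable⇒+deficitSum≡sum : ∀ ws {k} → Representable ws k →
  Σ (List Coef) λ us → k + deficitSum ws us ≡ sum ws
representable⇒+deficitSum≡sum ws {k} (us , length≡ , signedSum≡k) =
  us , ℤ.+-injective (begin
    + k ℤ.+ + deficitSum ws us            ≡⟨ cong (ℤ._+ + deficitSum ws us) (sym signedSum≡k) ⟩
    signedSum ws us ℤ.+ + deficitSum ws us ≡⟨ signedSum+deficitSum≡sum ws us length≡ ⟩
    + sum ws                              ∎)
  where open ≡-Reasoning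

deficit≤2* : ∀ u w → deficit u w ≤ 2 * w
deficit≤2* neg w = ≤-reflexive (cong (_+_ w) (sym (+-identityʳ w)))
deficit≤2* zer w = m≤m+n w (w + 0)
deficit≤2* pos w = z≤n

deficitSum≡0⊎≥ : ∀ {b} ws us → All (b ≤_) ws → deficitSum ws us ≡ 0 ⊎ b ≤ deficitSum ws us
deficitSum≡0⊎≥ []       us         _          = inj₁ refl
deficitSum≡0⊎≥ (w ∷ ws) []         _          = inj₁ refl
deficitSum≡0⊎≥ (w ∷ ws) (neg ∷ us) (b≤w ∷ _)  = inj₂ (≤-trans b≤w (≤-trans (m≤m+n w w) (m≤m+n (w + w) _)))
deficitSum≡0⊎≥ (w ∷ ws) (zer ∷ us) (b≤w ∷ _)  = inj₂ (≤-trans b≤w (m≤m+n w _))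
deficitSum≡0⊎≥ (w ∷ ws) (pos ∷ us) (_ ∷ b≤ws) = deficitSum≡0⊎≥ ws us b≤ws

deficitSum<⇒≤2*R : ∀ {b} j ws us → All (b ≤_) (drop j ws) → deficitSum ws us < b →
  deficitSum ws us ≤ 2 * R ws j
deficitSum<⇒≤2*R zero ws us b≤ws d<b with deficitSum≡0⊎≥ ws us b≤ws
... | inj₁ d≡0 = ≤-reflexive d≡0
... | inj₂ b≤d = contradiction b≤d (<⇒≱ d<b)
deficitSum<⇒≤2*R (suc j) []       us       _    _   = z≤n
deficitSum<⇒≤2*R (suc j) (w ∷ ws) []       _    _   = z≤n
deficitSum<⇒≤2*R (suc j) (w ∷ ws) (u ∷ us) b≤ws d<b = begin
  deficit u w + deficitSum ws us ≤⟨ +-mono-≤ (deficit≤2* u w) tail≤ ⟩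
  2 * w + 2 * R ws j             ≡⟨ *-distribˡ-+ 2 w (R ws j) ⟨
  2 * (w + R ws j)               ∎
  where
  open ≤-Reasoning
  tail≤ : deficitSum ws us ≤ 2 * R ws j
  tail≤ = deficitSum<⇒≤2*R j ws us b≤ws (≤-<-trans (m≤n+m _ (deficit u w)) d<b)

drop-∷ : ∀ j (ws : List ℕ) → j < length ws → Σ ℕ λ x → Σ (List ℕ) λ xs → drop j ws ≡ x ∷ xs
drop-∷ zero    (w ∷ ws) _       = w , ws , refl
drop-∷ (suc j) (w ∷ ws) (s≤s j<) = drop-∷ j ws j<

R-suc : ∀ j ws {x xs} → drop j ws ≡ x ∷ xs → R ws (suc j) ≡ R ws j + x
R-suc zero    (w ∷ ws) refl = +-identityʳ w
R-suc (suc j) (w ∷ ws) eq   = trans (cong (_+_ w) (R-suc j ws eq)) (sym (+-assoc w _ _))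

R≤sum : ∀ j ws → R ws j ≤ sum ws
R≤sum j ws = begin
  sum (take j ws)                      ≤⟨ m≤m+n _ _ ⟩
  sum (take j ws) + sum (drop j ws)    ≡⟨ sum-++ (take j ws) (drop j ws) ⟨
  sum (take j ws ++ drop j ws)         ≡⟨ cong sum (take++drop≡id j ws) ⟩
  sum ws                               ∎
  where open ≤-Reasoning

sorted-drop⇒head≤ : ∀ {ws} j {x xs} → Sorted ≤-totalOrder ws → drop j ws ≡ x ∷ xs →
  All (x ≤_) (drop j ws)
sorted-drop⇒head≤ j {x} {xs} sorted eq =
  subst (All (x ≤_)) (sym eq) (head≤ (subst (AllPairs _≤_) eq (drop⁺ j (Linked⇒AllPairs ≤-trans sorted))))
  where
  head≤ : AllPairs _≤_ (x ∷ xs) → All (x ≤_) (x ∷ xs)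
  head≤ (x≤xs ∷ _) = ≤-refl ∷ x≤xs

deficitSum≢2*R+1 : ∀ {ws} j {x xs} → Sorted ≤-totalOrder ws → drop j ws ≡ x ∷ xs →
  2 * R ws j + 1 < x → ∀ us → deficitSum ws us ≢ 2 * R ws j + 1
deficitSum≢2*R+1 {ws} j sorted eq 2R+1<x us d≡2R+1 =
  <⇒≱ (subst (2 * R ws j <_) (sym d≡2R+1) (m<m+n _ z<s))
      (deficitSum<⇒≤2*R j ws us (sorted-drop⇒head≤ j sorted eq) (subst (_< _) (sym d≡2R+1) 2R+1<x))

sorted∧covers⇒part≤2*R+1 : ∀ {ws} → Sorted ≤-totalOrder ws → Covers (sum ws) ws →
  ∀ j {x xs} → drop j ws ≡ x ∷ xs → x ≤ 2 * R ws j + 1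
sorted∧covers⇒part≤2*R+1 {ws} sorted covers j {x} eq with x ≤? 2 * R ws j + 1
... | yes x≤2R+1 = x≤2R+1
... | no x≰2R+1 = contradiction d≡2R+1 (deficitSum≢2*R+1 j sorted eq 2R+1<x us)
  where
  2R+1<x : 2 * R ws j + 1 < x
  2R+1<x = ≰⇒> x≰2R+1
  x≤sum : x ≤ sum ws
  x≤sum = begin
    x             ≤⟨ m≤n+m x _ ⟩
    R ws j + x    ≡⟨ R-suc j ws eq ⟨
    R ws (suc j)  ≤⟨ R≤sum (suc j) ws ⟩
    sum ws        ∎
    where open ≤-Reasoning
  2R+1≤sum : 2 * R ws j + 1 ≤ sum ws
  2R+1≤sum = <⇒≤ (<-≤-trans 2R+1<x x≤sum)
  k = sum ws ∸ (2 * R ws j + 1)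
  representation = representable⇒+deficitSum≡sum ws
    (covers k (m<n⇒0<n∸m (<-≤-trans 2R+1<x x≤sum)) (m∸n≤m (sum ws) (2 * R ws j + 1)))
  us = proj₁ representation
  d≡2R+1 : deficitSum ws us ≡ 2 * R ws j + 1
  d≡2R+1 = +-cancelˡ-≡ k _ _ (trans (proj₂ representation) (sym (m∸n+n≡m 2R+1≤sum)))

mainTheorem6 : (n : ℕ) → 1 ≤ n → (ws : List ℕ) → Feasible n ws →
    (i : ℕ) → 1 ≤ i → i ≤ length ws →
    R ws i ≤ 3 * R ws (i ∸ 1) + 1
mainTheorem6 n _ ws (sorted , (_ , sum≡n , covers) , _) (suc j) _ j<length
  with drop-∷ j ws j<length
... | x , xs , eq = begin
  R ws (suc j)                ≡⟨ R-suc j ws eq ⟩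
  R ws j + x                  ≤⟨ +-monoʳ-≤ (R ws j) (sorted∧covers⇒part≤2*R+1 sorted covers′ j eq) ⟩
  R ws j + (2 * R ws j + 1)   ≡⟨ r+[2r+1]≡3r+1 (R ws j) ⟩
  3 * R ws j + 1              ∎
  where
  open ≤-Reasoning
  covers′ : Covers (sum ws) ws
  covers′ = subst (λ m → Covers m ws) (sym sum≡n) covers
  r+[2r+1]≡3r+1 : ∀ r → r + (2 * r + 1) ≡ 3 * r + 1
  r+[2r+1]≡3r+1 = ℕ-Solver.solve-∀
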